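{- Let $G$ be a finite abelian group, let $A = \{a_1,\dots,a_n\}$ be a nonempty subset of $G$ not contained in any proper subgroup, and let $\sigma$ be an automorphism of $G$. Then $h^c_G(A) = h^c_G(\sigma(A))$ and $w_G(A) = w_G(\sigma(A))$. In addition, if $0 \notin A$, then $w_G(A) = w_G(\{ -a_1, a_2 - a_1,\dots,a_n-a_1\})$.
   Context: For $A\subseteq G$ and positive integer $k$, $kA=\{x_1+\dots+x_k:x_i\in A\}$. For nonempty $A$, the coheight $h^c_G(A)$ is the least positive integer $k$ with $0\in kA$. For nonempty $A$ not contained in a proper subgroup, the width $w_G(A)$ is the least positive integer $k$ such that every element of $G$ is a sum of at most $k$ elements of $A$. -}

module Defs where

open import Level using (Level; _⊔_; suc)
open import Algebra.Bundles using (AbelianGroup)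
open import Algebra.Morphism.Structures using (module GroupMorphisms)
open import Data.Nat using (ℕ; _≤_; _<_)
open import Data.Fin using (Fin)
open import Data.Vec using (Vec; foldr)
open import Data.Vec.Relation.Unary.All using (All)
open import Data.List using (List; _∷_; map)
open import Data.Product using (Σ; ∃; _×_)
open import Function.Bundles using (Inverse)
open import Relation.Nullary using (¬_)
open import Relation.Unary using (Pred)
import Relation.Binary.PropositionalEquality as ≡
import Data.List.Membership.Setoid as SetoidMembership

module _ {c ℓ : Level} (G : AbelianGroup c ℓ) where
  open AbelianGroup G

  Finite : Set (c ⊔ ℓ)
  Finite = Σ ℕ λ n → Inverse (≡.setoid (Fin n)) setoid

  -- a finite subset of G, given by a list of its elements (a₁ , … , aₙ),
  -- with membership taken up to the group's equality _≈_
  _∈_ : Carrier → List Carrier → Set (c ⊔ ℓ)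
  x ∈ A = SetoidMembership._∈_ setoid x A

  IsAutomorphism : (Carrier → Carrier) → Set (c ⊔ ℓ)
  IsAutomorphism σ = GroupMorphisms.IsGroupIsomorphism rawGroup rawGroup σ

  record IsSubgroup (H : Pred Carrier (c ⊔ ℓ)) : Set (c ⊔ ℓ) where
    field
      resp : ∀ {x y} → x ≈ y → H x → H y
      ε∈   : H ε
      ∙∈   : ∀ {x y} → H x → H y → H (x ∙ y)
      ⁻¹∈  : ∀ {x} → H x → H (x ⁻¹)

  NotInProperSubgroup : List Carrier → Set (suc (c ⊔ ℓ))
  NotInProperSubgroup A =
    (H : Pred Carrier (c ⊔ ℓ)) → IsSubgroup H →
    (∀ {a} → a ∈ A → H a) → ∀ x → H x

  vsum : ∀ {k} → Vec Carrier k → Carrier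
  vsum = foldr _ _∙_ ε

  -- g ∈ kA : g is a sum of k elements of A (repetitions allowed)
  InSumset : ℕ → List Carrier → Carrier → Set (c ⊔ ℓ)
  InSumset k A g = Σ (Vec Carrier k) λ v → All (_∈ A) v × vsum v ≈ g

  IsCoheight : List Carrier → ℕ → Set (c ⊔ ℓ)
  IsCoheight A h =
    1 ≤ h × InSumset h A ε × (∀ j → 1 ≤ j → j < h → ¬ InSumset j A ε)

  CoversWithin : List Carrier → ℕ → Set (c ⊔ ℓ)
  CoversWithin A k = ∀ g → Σ ℕ λ j → j ≤ k × InSumset j A g

  IsWidth : List Carrier → ℕ → Set (c ⊔ ℓ)
  IsWidth A w =
    1 ≤ w × CoversWithin A w × (∀ j → 1 ≤ j → j < w → ¬ CoversWithin A j)

module Submission where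

-- Both h^c_G(A) and w_G(A) are "least positive k such that P k" for a
-- property P of k (0 ∈ kA, resp. G ⊆ A ∪ 2A ∪ … ∪ kA).  So it suffices to
-- show that the relevant property P k is equivalent, for every k, for the
-- two sets being compared; `least-positive-⇔` then transfers minimality.
--
-- Automorphisms.  σ maps sums of k elements of A to sums of k elements of
-- σ(A), and since σ is bijective every such sum comes back from A.  Hence
-- 0 ∈ kA ⇔ 0 ∈ kσ(A) and A covers G in ≤ k steps iff σ(A) does.
--
-- Translation.  "Every g is a sum of at most k elements of A" is the same as
-- "every g is a sum of exactly k elements of A ∪ {0}" (pad with zeros).  If
-- x ↦ x - a₁ maps A ∪ {0} into B ∪ {0}, then a k-term sum over A ∪ {0} of
-- g + k·a₁ becomes a k-term sum over B ∪ {0} of g; so covering transfers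
-- from A to B.  For B = {-a₁, a₂ - a₁, …, aₙ - a₁} the translation by -a₁
-- maps A ∪ {0} into B ∪ {0} and translation by a₁ maps back, giving both
-- directions.

open import Defs
open import Level using (Level; _⊔_)
open import Algebra.Bundles using (AbelianGroup)
open import Algebra.Morphism.Structures using (module GroupMorphisms)
import Algebra.Definitions.RawMonoid as MonoidDefinitions
import Algebra.Properties.CommutativeSemigroup as CommutativeSemigroupProperties
open import Data.Nat using (ℕ; suc; _≤_; _<_; _≤′_; ≤′-refl; ≤′-step; z≤n; s≤s)
open import Data.Nat.Properties using (≤⇒≤′; m≤n⇒m≤1+n)
open import Data.List using (List; _∷_; map)
open import Data.List.Relation.Unary.Any using (here; there)
import Data.List.Membership.Setoid.Properties as Membership
open import Data.Vec using (Vec; []; _∷_)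
import Data.Vec as Vec
open import Data.Vec.Relation.Unary.All using (All; []; _∷_)
import Data.Vec.Relation.Unary.All as All
open import Data.Product using (_×_; _,_; Σ)
open import Data.Sum using (_⊎_; inj₁; inj₂)
open import Function.Bundles using (_⇔_; mk⇔; Equivalence)
open import Relation.Nullary using (¬_)

least-positive-⇔ : ∀ {a} {P Q : ℕ → Set a} → (∀ j → P j ⇔ Q j) → (h : ℕ) →
  (1 ≤ h × P h × (∀ j → 1 ≤ j → j < h → ¬ P j)) ⇔
  (1 ≤ h × Q h × (∀ j → 1 ≤ j → j < h → ¬ Q j))
least-positive-⇔ P⇔Q h = mk⇔
  (λ (1≤h , Ph , least) → 1≤h , to (P⇔Q h) Ph , λ j 1≤j j<h Qj → least j 1≤j j<h (from (P⇔Q j) Qj))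
  (λ (1≤h , Qh , least) → 1≤h , from (P⇔Q h) Qh , λ j 1≤j j<h Pj → least j 1≤j j<h (to (P⇔Q j) Pj))
  where open Equivalence

module _ {c ℓ : Level} (G : AbelianGroup c ℓ) where
  open AbelianGroup G
  open CommutativeSemigroupProperties commutativeSemigroup using (interchange)
  open MonoidDefinitions rawMonoid using () renaming (_×_ to _·_)

  SumOf : ℕ → (Carrier → Set (c ⊔ ℓ)) → Carrier → Set (c ⊔ ℓ)
  SumOf k P g = Σ (Vec Carrier k) λ v → All P v × vsum G v ≈ g

  SumOf-resp : ∀ {k P g h} → g ≈ h → SumOf k P g → SumOf k P h
  SumOf-resp g≈h (v , all , sum≈g) = v , all , trans sum≈g g≈h

  module Automorphism (σ : Carrier → Carrier) (σ-aut : IsAutomorphism G σ) where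
    open GroupMorphisms.IsGroupIsomorphism σ-aut

    vsum-map : ∀ {k} (v : Vec Carrier k) → vsum G (Vec.map σ v) ≈ σ (vsum G v)
    vsum-map []      = sym ε-homo
    vsum-map (x ∷ v) = trans (∙-congˡ (vsum-map v)) (sym (∙-homo x (vsum G v)))

    sumset-image : ∀ {k A g} → InSumset G k A g → InSumset G k (map σ A) (σ g)
    sumset-image (v , v⊆A , sum≈g) =
      Vec.map σ v , images v v⊆A , trans (vsum-map v) (⟦⟧-cong sum≈g)
      where
      images : ∀ {k A} (v : Vec Carrier k) → All (λ x → _∈_ G x A) v →
               All (λ x → _∈_ G x (map σ A)) (Vec.map σ v)
      images []      []         = []
      images (x ∷ v) (x∈A ∷ v⊆A) = Membership.∈-map⁺ setoid setoid ⟦⟧-cong x∈A ∷ images v v⊆A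

    sum-preimage : ∀ {k A} (v : Vec Carrier k) → All (λ x → _∈_ G x (map σ A)) v →
                   Σ (Vec Carrier k) λ u → All (λ x → _∈_ G x A) u × σ (vsum G u) ≈ vsum G v
    sum-preimage []      []           = [] , [] , ε-homo
    sum-preimage (x ∷ v) (x∈σA ∷ v⊆σA) with Membership.∈-map⁻ setoid setoid x∈σA | sum-preimage v v⊆σA
    ... | a , a∈A , x≈σa | u , u⊆A , σu≈v =
      a ∷ u , a∈A ∷ u⊆A , trans (∙-homo a (vsum G u)) (∙-cong (sym x≈σa) σu≈v)

    sumset-preimage : ∀ {k A g} → InSumset G k (map σ A) (σ g) → InSumset G k A g
    sumset-preimage (v , v⊆σA , sum≈σg) with sum-preimage v v⊆σA
    ... | u , u⊆A , σu≈v = u , u⊆A , injective (trans σu≈v sum≈σg)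

    zero-sum-⇔ : ∀ A k → InSumset G k A ε ⇔ InSumset G k (map σ A) ε
    zero-sum-⇔ A k = mk⇔
      (λ 0∈kA → SumOf-resp ε-homo (sumset-image 0∈kA))
      (λ 0∈kσA → sumset-preimage (SumOf-resp (sym ε-homo) 0∈kσA))

    covers-⇔ : ∀ A k → CoversWithin G A k ⇔ CoversWithin G (map σ A) k
    covers-⇔ A k = mk⇔ forward backward
      where
      forward : CoversWithin G A k → CoversWithin G (map σ A) k
      forward covers g with surjective g
      ... | x , σx≈g with covers x
      ... | j , j≤k , x∈jA = j , j≤k , SumOf-resp (σx≈g refl) (sumset-image x∈jA)

      backward : CoversWithin G (map σ A) k → CoversWithin G A k
      backward covers g with covers (σ g)
      ... | j , j≤k , σg∈jσA = j , j≤k , sumset-preimage σg∈jσA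

  WithZero : List Carrier → Carrier → Set (c ⊔ ℓ)
  WithZero A x = _∈_ G x A ⊎ x ≈ ε

  pad : ∀ {P j k g} → P ε → j ≤′ k → SumOf j P g → SumOf k P g
  pad P0 ≤′-refl        s = s
  pad P0 (≤′-step j≤k) s with pad P0 j≤k s
  ... | v , all , sum≈g = ε ∷ v , P0 ∷ all , trans (identityˡ (vsum G v)) sum≈g

  unpad : ∀ {A k g} → SumOf k (WithZero A) g → Σ ℕ λ j → j ≤ k × InSumset G j A g
  unpad ([] , [] , sum≈g) = 0 , z≤n , [] , [] , sum≈g
  unpad (x ∷ v , x∈A₀ ∷ all , sum≈g) with unpad (v , all , refl)
  ... | j , j≤k , u , u⊆A , u≈v with x∈A₀
  ...   | inj₁ x∈A = suc j , s≤s j≤k , x ∷ u , x∈A ∷ u⊆A , trans (∙-congˡ u≈v) sum≈g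
  ...   | inj₂ x≈ε = j , m≤n⇒m≤1+n j≤k , u , u⊆A ,
                     trans u≈v (trans (sym (identityˡ (vsum G v))) (trans (∙-congʳ (sym x≈ε)) sum≈g))

  covers-⇔-exact : ∀ A k → CoversWithin G A k ⇔ (∀ g → SumOf k (WithZero A) g)
  covers-⇔-exact A k = mk⇔
    (λ covers g → at-most⇒exact (covers g))
    (λ exact g → unpad (exact g))
    where
    at-most⇒exact : ∀ {g} → Σ ℕ (λ j → j ≤ k × InSumset G j A g) → SumOf k (WithZero A) g
    at-most⇒exact (j , j≤k , v , v⊆A , sum≈g) =
      pad (inj₂ refl) (≤⇒≤′ j≤k) (v , All.map inj₁ v⊆A , sum≈g)

  shift : ∀ {k P Q g} (d : Carrier) → (∀ {x} → P x → Q (x ∙ d)) →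
          SumOf k P g → SumOf k Q (g ∙ k · d)
  shift d P⇒Q ([] , [] , sum≈g) = [] , [] , trans (sym (identityʳ ε)) (∙-congʳ sum≈g)
  shift {suc k} d P⇒Q (x ∷ v , Px ∷ all , sum≈g) with shift d P⇒Q (v , all , refl)
  ... | u , u⊆Q , u≈v+kd = x ∙ d ∷ u , P⇒Q Px ∷ u⊆Q ,
        trans (∙-congˡ u≈v+kd) (trans (interchange x d (vsum G v) (k · d)) (∙-congʳ sum≈g))

  -- If translation by d maps A ∪ {0} into B ∪ {0}, then B covers G in at
  -- most k steps whenever A does: write g - k·d over A ∪ {0} and shift.
  covers-translate : ∀ {A B k} (d : Carrier) → (∀ {x} → WithZero A x → WithZero B (x ∙ d)) →
                     CoversWithin G A k → CoversWithin G B k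
  covers-translate {A} {B} {k} d translate covers =
    from (covers-⇔-exact B k) λ g →
      SumOf-resp (g-kd+kd g) (shift d translate (to (covers-⇔-exact A k) covers (g ∙ (k · d) ⁻¹)))
    where
    open Equivalence
    g-kd+kd : ∀ g → (g ∙ (k · d) ⁻¹) ∙ k · d ≈ g
    g-kd+kd g = trans (assoc g _ _) (trans (∙-congˡ (inverseˡ (k · d))) (identityʳ g))

  -- The normalisation A = {a₁, …, aₙ} ↦ B = {-a₁, a₂ - a₁, …, aₙ - a₁},
  -- i.e. B ∪ {0} = (A ∪ {0}) - a₁.
  module Normalisation (a₁ : Carrier) (as : List Carrier) where
    A B : List Carrier
    A = a₁ ∷ as
    B = (a₁ ⁻¹) ∷ map (λ a → a ∙ (a₁ ⁻¹)) as

    x-a₁+a₁≈x : ∀ x → (x ∙ a₁ ⁻¹) ∙ a₁ ≈ x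
    x-a₁+a₁≈x x = trans (assoc x (a₁ ⁻¹) a₁) (trans (∙-congˡ (inverseˡ a₁)) (identityʳ x))

    A-to-B : ∀ {x} → WithZero A x → WithZero B (x ∙ a₁ ⁻¹)
    A-to-B (inj₂ x≈ε)           = inj₁ (here (trans (∙-congʳ x≈ε) (identityˡ _)))
    A-to-B (inj₁ (here x≈a₁))   = inj₂ (trans (∙-congʳ x≈a₁) (inverseʳ a₁))
    A-to-B (inj₁ (there x∈as))  = inj₁ (there (Membership.∈-map⁺ setoid setoid ∙-congʳ x∈as))

    B-to-A : ∀ {x} → WithZero B x → WithZero A (x ∙ a₁)
    B-to-A (inj₂ x≈ε)           = inj₁ (here (trans (∙-congʳ x≈ε) (identityˡ _)))
    B-to-A (inj₁ (here x≈-a₁))  = inj₂ (trans (∙-congʳ x≈-a₁) (inverseˡ a₁))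
    B-to-A (inj₁ (there x∈as-a₁)) with Membership.∈-map⁻ setoid setoid x∈as-a₁
    ... | a , a∈as , x≈a-a₁ = inj₁ (there (Membership.∈-resp-≈ setoid
          (sym (trans (∙-congʳ x≈a-a₁) (x-a₁+a₁≈x a))) a∈as))

    covers-⇔ : ∀ k → CoversWithin G A k ⇔ CoversWithin G B k
    covers-⇔ k = mk⇔ (covers-translate (a₁ ⁻¹) A-to-B) (covers-translate a₁ B-to-A)

lemma4 : {c ℓ : Level} (G : AbelianGroup c ℓ) → Finite G →
         let open AbelianGroup G in
         (a₁ : Carrier) (as : List Carrier) →
         NotInProperSubgroup G (a₁ ∷ as) →
         (σ : Carrier → Carrier) → IsAutomorphism G σ →
         ((k : ℕ) → IsCoheight G (a₁ ∷ as) k ⇔ IsCoheight G (map σ (a₁ ∷ as)) k)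
         × ((k : ℕ) → IsWidth G (a₁ ∷ as) k ⇔ IsWidth G (map σ (a₁ ∷ as)) k)
         × (¬ _∈_ G ε (a₁ ∷ as) →
            (k : ℕ) → IsWidth G (a₁ ∷ as) k
                      ⇔ IsWidth G ((a₁ ⁻¹) ∷ map (λ a → a ∙ (a₁ ⁻¹)) as) k)
lemma4 G _ a₁ as _ σ σ-aut =
    least-positive-⇔ (σ.zero-sum-⇔ (a₁ ∷ as))
  , least-positive-⇔ (σ.covers-⇔ (a₁ ∷ as))
  , λ _ → least-positive-⇔ (Normalisation.covers-⇔ G a₁ as)
  where module σ = Automorphism G σ σ-aut
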